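{- Let $\mathfrak{a}=(a_1,\ldots,a_p)$ and $\mathfrak{b}=(b_1,\ldots,b_p)$ be sequences of integers with $a_1\ge b_1>a_2\ge b_2>\cdots>a_p\ge b_p$. Let $\mathfrak{c}=(c_1,\ldots,c_k)$ be a length $k$ subsequence of $\mathfrak{a}$ and $\mathfrak{d}=(d_1,\ldots,d_k)$ a length $k$ subsequence of $\mathfrak{b}$. If all entries of $\mathfrak{a}|_{\mathfrak{c}\leftarrow\mathfrak{d}}$ are distinct and all entries of $\mathfrak{b}|_{\mathfrak{d}\leftarrow\mathfrak{c}}$ are distinct, then $\mathrm{inv}(\mathfrak{a}|_{\mathfrak{c}\leftarrow\mathfrak{d}})=\mathrm{inv}(\mathfrak{b}|_{\mathfrak{d}\leftarrow\mathfrak{c}})$.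
   Context: Subsequences keep the order of the original sequence. $\mathfrak{a}|_{\mathfrak{c}\leftarrow\mathfrak{d}}$ is the sequence obtained from $\mathfrak{a}$ by replacing, for each $i$, the entry $c_i$ (in the position where it occurs in $\mathfrak{a}$) by $d_i$; $\mathfrak{b}|_{\mathfrak{d}\leftarrow\mathfrak{c}}$ is defined analogously. For a sequence $(x_1,\ldots,x_p)$, $\mathrm{inv}$ is the number of pairs $i<j$ with $x_i>x_j$. -}

module Defs where

open import Data.Nat using (ℕ; zero; suc; _+_)
open import Data.Integer using (ℤ; _≤_; _<_; _<?_)
open import Data.Fin using (Fin; zero; suc; _≟_)
import Data.Fin as F
open import Data.Maybe using (Maybe; just; nothing)
open import Data.List using (List; length; filter)
open import Data.List using (allFin; cartesianProduct)
open import Data.Product using (_×_; _,_; proj₁; proj₂)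
open import Relation.Nullary using (yes; no)
open import Relation.Nullary.Decidable using (_×-dec_)

Seq : ℕ → Set
Seq p = Fin p → ℤ

Interlacing : ∀ {p} → Seq p → Seq p → Set
Interlacing {p} a b =
  ((i : Fin p) → b i ≤ a i) ×
  ((i : Fin p) (j : Fin p) → F.toℕ j ≡ suc (F.toℕ i) → a j < b i)
  where open import Relation.Binary.PropositionalEquality using (_≡_)

-- An index selection σ : Fin k → Fin p, strictly increasing; it determines
-- the length-k subsequence (x (σ 1), …, x (σ k)) of x (order is kept).
StrictlyIncreasing : ∀ {k p} → (Fin k → Fin p) → Set
StrictlyIncreasing {k} σ = (i j : Fin k) → i F.< j → σ i F.< σ j

preimage : ∀ {k p} → (Fin k → Fin p) → Fin p → Maybe (Fin k)
preimage {zero}  σ j = nothing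
preimage {suc k} σ j with σ zero ≟ j
... | yes _ = just zero
... | no  _ with preimage (λ i → σ (suc i)) j
...   | just i  = just (suc i)
...   | nothing = nothing

replace : ∀ {k p} → Seq p → (Fin k → Fin p) → Seq k → Seq p
replace x σ d j with preimage σ j
... | just i  = d i
... | nothing = x j

Distinct : ∀ {p} → Seq p → Set
Distinct {p} x = (i j : Fin p) → x i ≡ x j → i ≡ j
  where open import Relation.Binary.PropositionalEquality using (_≡_)

inv : ∀ {p} → Seq p → ℕ
inv {p} x = length (filter (λ ij → (proj₁ ij F.<? proj₂ ij) ×-dec (x (proj₂ ij) <? x (proj₁ ij)))
                           (cartesianProduct (allFin p) (allFin p)))

-- Record every entry of x = 𝔞|_{𝔠←𝔡} and y = 𝔟|_{𝔡←𝔠} by its rank in the merged chain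
-- a₁ ≥ b₁ > a₂ ≥ b₂ > ⋯.  As the entries are distinct, a pair of positions is an inversion
-- exactly when it is not a descent of the ranks, so it suffices to count rank descents.
-- Unselected positions carry ranks increasing with the position, and so do the selected
-- ones, hence every descent pairs a selected position σ i (or τ i) with an unselected one.
-- Counted over all positions, the positions discordant with the i-th selected entry number
-- #{j strictly between σ i and τ i} + [σ i < τ i] for both x and y, and the selected positions
-- among them are matched by exchanging the roles of i and i′.
module Submission where

open import Defs
open import Data.Bool using (Bool; true; false; if_then_else_)
open import Data.Fin using (Fin; zero; suc; toℕ; fromℕ<; _≟_; _<_; _≤_; _<?_; _≤?_)
import Data.Fin.Properties as Finₚ
open import Data.Integer as ℤ using (ℤ)
import Data.Integer.Properties as ℤₚ
open import Data.List using (List; length; filter; tabulate; cartesianProduct; map; _++_)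
open import Data.List.Properties using (filter-++; length-++; map-tabulate)
open import Data.Maybe using (just; nothing; maybe′)
open import Data.Nat as ℕ using (ℕ; zero; suc; _+_; _*_; _∸_; s≤s)
open import Data.Nat.Properties
  using (+-identityʳ; +-assoc; +-comm; +-suc; *-comm; *-zeroʳ; *-identityˡ; *-identityʳ;
         *-distribˡ-+; *-distribʳ-+; *-suc; *-monoʳ-≤; *-cancelˡ-≤; +-cancelʳ-≡;
         ≤-refl; ≤-reflexive; ≤-trans; <⇒≤; <⇒≢; <⇒≱; <⇒≯; ≤⇒≯; ≮⇒≥; <-irrefl; <-asym;
         n≤1+n; m+[n∸m]≡n; +-*-semiring)
open import Data.Nat.Tactic.RingSolver using (solve-∀)
open import Algebra.Properties.Semiring.Sum +-*-semiring
  using (sum-syntax; sum-cong-≗; sum-replicate-zero; ∑-distrib-+; ∑-comm;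
         *-distribˡ-sum; *-distribʳ-sum)
open import Data.Product using (_×_; _,_; proj₁; proj₂)
open import Function using (_∘_; id; Injective)
open import Relation.Binary using (tri<; tri≈; tri>)
open import Relation.Binary.PropositionalEquality
open import Relation.Nullary using (Dec; yes; no; does; ¬_; contradiction)
open import Relation.Nullary.Decidable using (_×-dec_; dec-true; dec-false)

open ≡-Reasoning

𝟙 : {P : Set} → Dec P → ℕ
𝟙 d = if does d then 1 else 0

𝟙-yes : {P : Set} (d : Dec P) → P → 𝟙 d ≡ 1
𝟙-yes d p rewrite dec-true d p = refl

𝟙-no : {P : Set} (d : Dec P) → ¬ P → 𝟙 d ≡ 0
𝟙-no d ¬p rewrite dec-false d ¬p = refl

𝟙-cong : {P Q : Set} (d : Dec P) (e : Dec Q) → (P → Q) → (Q → P) → 𝟙 d ≡ 𝟙 e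
𝟙-cong (yes p) e P→Q Q→P = sym (𝟙-yes e (P→Q p))
𝟙-cong (no ¬p) e P→Q Q→P = sym (𝟙-no e (¬p ∘ Q→P))

𝟙-×-dec : {P Q : Set} (d : Dec P) (e : Dec Q) → 𝟙 (d ×-dec e) ≡ 𝟙 d * 𝟙 e
𝟙-×-dec (yes _) e = sym (+-identityʳ (𝟙 e))
𝟙-×-dec (no _)  e = refl

𝟙-≟-sym : ∀ {n} (i j : Fin n) → 𝟙 (i ≟ j) ≡ 𝟙 (j ≟ i)
𝟙-≟-sym i j = 𝟙-cong (i ≟ j) (j ≟ i) sym sym

𝟙-≟-transport : ∀ {n} {P : Fin n → Set} (P? : ∀ i → Dec (P i)) (i j : Fin n) →
                𝟙 (P? j) * 𝟙 (i ≟ j) ≡ 𝟙 (i ≟ j) * 𝟙 (P? i)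
𝟙-≟-transport P? i j with i ≟ j
... | yes refl = *-comm (𝟙 (P? i)) 1
... | no _     = *-zeroʳ (𝟙 (P? j))

𝟙-≤-split : ∀ {n} (i j : Fin n) → 𝟙 (i ≤? j) ≡ 𝟙 (i <? j) + 𝟙 (i ≟ j)
𝟙-≤-split i j with Finₚ.<-cmp i j
... | tri< i<j i≢j _
  rewrite 𝟙-yes (i ≤? j) (<⇒≤ i<j) | 𝟙-yes (i <? j) i<j | 𝟙-no (i ≟ j) i≢j = refl
... | tri≈ i≮i refl _
  rewrite 𝟙-yes (i ≤? i) ≤-refl | 𝟙-no (i <? i) i≮i | 𝟙-yes (i ≟ i) refl = refl
... | tri> i≮j i≢j j<i
  rewrite 𝟙-no (i ≤? j) (<⇒≱ j<i) | 𝟙-no (i <? j) i≮j | 𝟙-no (i ≟ j) i≢j = refl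

𝟙-1+2m<2n : ∀ m n → 𝟙 (suc (2 * m) ℕ.<? 2 * n) ≡ 𝟙 (m ℕ.<? n)
𝟙-1+2m<2n m n = 𝟙-cong (suc (2 * m) ℕ.<? 2 * n) (m ℕ.<? n)
  (λ 2+2m≤2n → *-cancelˡ-≤ 2 (≤-trans (≤-reflexive (*-suc 2 m)) 2+2m≤2n))
  (λ m<n → ≤-trans (≤-reflexive (sym (*-suc 2 m))) (*-monoʳ-≤ 2 m<n))

𝟙-2m<1+2n : ∀ m n → 𝟙 (2 * m ℕ.<? suc (2 * n)) ≡ 𝟙 (m ℕ.≤? n)
𝟙-2m<1+2n m n = 𝟙-cong (2 * m ℕ.<? suc (2 * n)) (m ℕ.≤? n)
  (λ { (s≤s 2m≤2n) → *-cancelˡ-≤ 2 2m≤2n }) (λ m≤n → s≤s (*-monoʳ-≤ 2 m≤n))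

∑-zero : ∀ {n} (f : Fin n → ℕ) → (∀ i → f i ≡ 0) → ∑[ i < n ] f i ≡ 0
∑-zero {n} f f≡0 = trans (sum-cong-≗ f≡0) (sum-replicate-zero n)

∑-δ : ∀ {n} (l : Fin n) (f : Fin n → ℕ) → ∑[ j < n ] (𝟙 (l ≟ j) * f j) ≡ f l
∑-δ {suc n} zero f =
  trans (cong₂ _+_ (+-identityʳ (f zero)) (sum-replicate-zero n)) (+-identityʳ (f zero))
∑-δ {suc n} (suc l) f = ∑-δ l (f ∘ suc)

length-filter-tabulate : ∀ {n} {A : Set} {P : A → Set} (P? : ∀ x → Dec (P x)) (f : Fin n → A) →
                         length (filter P? (tabulate f)) ≡ ∑[ i < n ] 𝟙 (P? (f i))
length-filter-tabulate {zero}  P? f = refl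
length-filter-tabulate {suc n} P? f with P? (f zero)
... | yes _ = cong suc (length-filter-tabulate P? (f ∘ suc))
... | no _  = length-filter-tabulate P? (f ∘ suc)

length-filter-cartesianProduct :
  ∀ {m n} {A B : Set} {P : A × B → Set} (P? : ∀ x → Dec (P x)) (f : Fin m → A) (g : Fin n → B) →
  length (filter P? (cartesianProduct (tabulate f) (tabulate g)))
    ≡ ∑[ i < m ] ∑[ j < n ] 𝟙 (P? (f i , g j))
length-filter-cartesianProduct {zero}  P? f g = refl
length-filter-cartesianProduct {suc m} {A = A} {B} P? f g = begin
  length (filter P? (row ++ rest))                ≡⟨ cong length (filter-++ P? row rest) ⟩
  length (filter P? row ++ filter P? rest)        ≡⟨ length-++ (filter P? row) ⟩
  length (filter P? row) + length (filter P? rest)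
    ≡⟨ cong₂ _+_ (trans (cong (length ∘ filter P?) (map-tabulate g (f zero ,_)))
                        (length-filter-tabulate P? (λ j → f zero , g j)))
                 (length-filter-cartesianProduct P? (f ∘ suc) g) ⟩
  ∑[ j < _ ] 𝟙 (P? (f zero , g j)) + ∑[ i < m ] ∑[ j < _ ] 𝟙 (P? (f (suc i) , g j)) ∎
  where
  row : List (A × B)
  row = map (f zero ,_) (tabulate g)
  rest : List (A × B)
  rest = cartesianProduct (tabulate (f ∘ suc)) (tabulate g)

preimage-just : ∀ {k p} (σ : Fin k → Fin p) {j : Fin p} {i : Fin k} →
                preimage σ j ≡ just i → σ i ≡ j
preimage-just {suc k} σ {j} eq with σ zero ≟ j
preimage-just {suc k} σ refl | yes σ0≡j = σ0≡j
... | no _ with preimage (λ i → σ (suc i)) j in eq′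
preimage-just {suc k} σ refl | no _ | just i = preimage-just (λ i → σ (suc i)) eq′

preimage-image : ∀ {k p} (σ : Fin k → Fin p) → Injective _≡_ _≡_ σ → ∀ i → preimage σ (σ i) ≡ just i
preimage-image {suc k} σ σ-inj zero with σ zero ≟ σ zero
... | yes _ = refl
... | no σ0≢σ0 = contradiction refl σ0≢σ0
preimage-image {suc k} σ σ-inj (suc i) with σ zero ≟ σ (suc i)
... | yes σ0≡σi = contradiction (σ-inj σ0≡σi) λ ()
... | no _ rewrite preimage-image (λ i → σ (suc i)) (λ eq → Finₚ.suc-injective (σ-inj eq)) i = refl

preimage-nothing : ∀ {k p} (σ : Fin k → Fin p) → Injective _≡_ _≡_ σ →
                   ∀ {j} → preimage σ j ≡ nothing → ∀ i → σ i ≢ j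
preimage-nothing σ σ-inj eq i refl = contradiction (trans (sym (preimage-image σ σ-inj i)) eq) λ ()

fill : ∀ {k p} {A : Set} → (Fin p → A) → (Fin k → Fin p) → (Fin k → A) → Fin p → A
fill f σ g j = maybe′ g (f j) (preimage σ j)

replace≡fill : ∀ {k p} {A : Set} (h : A → ℤ) (f : Fin p → A) (σ : Fin k → Fin p) (g : Fin k → A) →
               ∀ j → replace (h ∘ f) σ (h ∘ g) j ≡ h (fill f σ g j)
replace≡fill h f σ g j with preimage σ j
... | just _  = refl
... | nothing = refl

fill-missing : ∀ {k p} {A : Set} (f : Fin p → A) {σ : Fin k → Fin p} (g : Fin k → A) →
               ∀ {j} → preimage σ j ≡ nothing → fill f σ g j ≡ f j
fill-missing f g eq = cong (maybe′ g (f _)) eq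

fill-image : ∀ {k p} {A : Set} (f : Fin p → A) {σ : Fin k → Fin p} (g : Fin k → A) →
             Injective _≡_ _≡_ σ → ∀ i → fill f σ g (σ i) ≡ g i
fill-image f {σ = σ} g σ-inj i = cong (maybe′ g (f (σ i))) (preimage-image σ σ-inj i)

offImage : ∀ {k p} → (Fin k → Fin p) → Fin p → ℕ
offImage σ = fill (λ _ → 1) σ (λ _ → 0)

offImage-*-cong : ∀ {k p} (σ : Fin k → Fin p) (j : Fin p) {x y : ℕ} →
                  (preimage σ j ≡ nothing → x ≡ y) → offImage σ j * x ≡ offImage σ j * y
offImage-*-cong σ j x≡y with preimage σ j
... | nothing = cong (1 *_) (x≡y refl)
... | just _  = refl

offImage+hits : ∀ {k p} {σ : Fin k → Fin p} → Injective _≡_ _≡_ σ →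
                ∀ j → offImage σ j + ∑[ i < k ] 𝟙 (σ i ≟ j) ≡ 1
offImage+hits {k} {σ = σ} σ-inj j with preimage σ j in eq
... | nothing = cong suc (∑-zero _ λ i → 𝟙-no (σ i ≟ j) (preimage-nothing σ σ-inj eq i))
... | just i₀ = begin
  ∑[ i < k ] 𝟙 (σ i ≟ j)       ≡⟨ sum-cong-≗ (λ i → trans (hit i) (sym (*-identityʳ _))) ⟩
  ∑[ i < k ] (𝟙 (i₀ ≟ i) * 1)  ≡⟨ ∑-δ i₀ (λ _ → 1) ⟩
  1                            ∎
  where
  hit : ∀ i → 𝟙 (σ i ≟ j) ≡ 𝟙 (i₀ ≟ i)
  hit i = 𝟙-cong (σ i ≟ j) (i₀ ≟ i) (λ σi≡j → σ-inj (trans (preimage-just σ eq) (sym σi≡j)))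
                 (λ { refl → preimage-just σ eq })

∑-split-image : ∀ {k p} {σ : Fin k → Fin p} → Injective _≡_ _≡_ σ → (f : Fin p → ℕ) →
                ∑[ j < p ] f j ≡ ∑[ j < p ] (offImage σ j * f j) + ∑[ i < k ] f (σ i)
∑-split-image {k} {p} {σ} σ-inj f = begin
  ∑[ j < p ] f j
    ≡⟨ sum-cong-≗ (λ j → sym (trans (cong (_* f j) (offImage+hits σ-inj j)) (*-identityˡ (f j)))) ⟩
  ∑[ j < p ] ((offImage σ j + hits j) * f j)
    ≡⟨ sum-cong-≗ (λ j → *-distribʳ-+ (f j) (offImage σ j) (hits j)) ⟩
  ∑[ j < p ] (offImage σ j * f j + hits j * f j)
    ≡⟨ ∑-distrib-+ (λ j → offImage σ j * f j) (λ j → hits j * f j) ⟩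
  ∑[ j < p ] (offImage σ j * f j) + ∑[ j < p ] (hits j * f j)
    ≡⟨ cong (∑[ j < p ] (offImage σ j * f j) +_) hits-sum ⟩
  ∑[ j < p ] (offImage σ j * f j) + ∑[ i < k ] f (σ i) ∎
  where
  hits : Fin p → ℕ
  hits j = ∑[ i < k ] 𝟙 (σ i ≟ j)
  hits-sum : ∑[ j < p ] (hits j * f j) ≡ ∑[ i < k ] f (σ i)
  hits-sum = begin
    ∑[ j < p ] (hits j * f j)
      ≡⟨ sum-cong-≗ (λ j → *-distribʳ-sum (f j) (λ i → 𝟙 (σ i ≟ j))) ⟩
    ∑[ j < p ] ∑[ i < k ] (𝟙 (σ i ≟ j) * f j)
      ≡⟨ ∑-comm (λ j i → 𝟙 (σ i ≟ j) * f j) ⟩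
    ∑[ i < k ] ∑[ j < p ] (𝟙 (σ i ≟ j) * f j)
      ≡⟨ sum-cong-≗ (λ i → ∑-δ (σ i) f) ⟩
    ∑[ i < k ] f (σ i) ∎

∑∑-split-image : ∀ {m k p} {σ : Fin k → Fin p} → Injective _≡_ _≡_ σ → (h : Fin p → Fin m → ℕ) →
                 ∑[ i < m ] ∑[ j < p ] (offImage σ j * h j i) + ∑[ i < m ] ∑[ i′ < k ] h (σ i′) i
                   ≡ ∑[ i < m ] ∑[ j < p ] h j i
∑∑-split-image {σ = σ} σ-inj h =
  trans (sym (∑-distrib-+ (λ i → ∑[ j < _ ] (offImage σ j * h j i)) (λ i → ∑[ i′ < _ ] h (σ i′) i)))
        (sum-cong-≗ λ i → sym (∑-split-image σ-inj (λ j → h j i)))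

module _ {k p} {σ : Fin k → Fin p} (σ↑ : StrictlyIncreasing σ) where

  strictlyIncreasing⇒injective : Injective _≡_ _≡_ σ
  strictlyIncreasing⇒injective {i} {j} σi≡σj with Finₚ.<-cmp i j
  ... | tri< i<j _ _ = contradiction (cong toℕ σi≡σj) (<⇒≢ (σ↑ i j i<j))
  ... | tri≈ _ i≡j _ = i≡j
  ... | tri> _ _ j<i = contradiction (cong toℕ (sym σi≡σj)) (<⇒≢ (σ↑ j i j<i))

  strictlyIncreasing-reflects-< : ∀ {i j} → σ i < σ j → i < j
  strictlyIncreasing-reflects-< {i} {j} σi<σj with Finₚ.<-cmp i j
  ... | tri< i<j _ _ = i<j
  ... | tri≈ _ refl _ = contradiction σi<σj (<-irrefl refl)
  ... | tri> _ _ j<i = contradiction σi<σj (<-asym (σ↑ j i j<i))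

inv≡∑ : ∀ {p} (z : Seq p) → inv z ≡ ∑[ i < p ] ∑[ j < p ] (𝟙 (i <? j) * 𝟙 (z j ℤ.<? z i))
inv≡∑ z = trans (length-filter-cartesianProduct inversion? id id)
                (sum-cong-≗ λ i → sum-cong-≗ λ j → 𝟙-×-dec (i <? j) (z j ℤ.<? z i))
  where
  inversion? : (ij : Fin _ × Fin _) → Dec ((proj₁ ij < proj₂ ij) × (z (proj₂ ij) ℤ.< z (proj₁ ij)))
  inversion? ij = (proj₁ ij <? proj₂ ij) ×-dec (z (proj₂ ij) ℤ.<? z (proj₁ ij))

descent : ∀ {p} → Fin p → ℕ → Fin p → ℕ → ℕ
descent i r j r′ = 𝟙 (i <? j) * 𝟙 (r′ ℕ.<? r)

discordant : ∀ {p} → Fin p → ℕ → Fin p → ℕ → ℕ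
discordant i r j r′ = descent i r j r′ + descent j r′ i r

descents : ∀ {p} → (Fin p → ℕ) → ℕ
descents {p} R = ∑[ i < p ] ∑[ j < p ] descent i (R i) j (R j)

descent-ordered : ∀ {p} {i j : Fin p} {r r′} → (i < j → r ℕ.≤ r′) → descent i r j r′ ≡ 0
descent-ordered {i = i} {j} {r} {r′} ordered with i <? j
... | yes i<j =
  trans (cong (𝟙 (i <? j) *_) (𝟙-no (r′ ℕ.<? r) (≤⇒≯ (ordered i<j)))) (*-zeroʳ (𝟙 (i <? j)))
... | no i≮j  = cong (_* 𝟙 (r′ ℕ.<? r)) (𝟙-no (i <? j) i≮j)

inv+descents : ∀ {p} (z : Seq p) (R : Fin p → ℕ) → Distinct z →
               (∀ i j → R i ℕ.≤ R j → z j ℤ.≤ z i) →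
               inv z + descents R ≡ ∑[ i < p ] ∑[ j < p ] 𝟙 (i <? j)
inv+descents {p} z R z-distinct antitone = begin
  inv z + descents R
    ≡⟨ cong (_+ descents R) (inv≡∑ z) ⟩
  ∑[ i < p ] ∑[ j < p ] inversion i j + descents R
    ≡⟨ sym (∑-distrib-+ (λ i → ∑[ j < p ] inversion i j)
                        (λ i → ∑[ j < p ] descent i (R i) j (R j))) ⟩
  ∑[ i < p ] (∑[ j < p ] inversion i j + ∑[ j < p ] descent i (R i) j (R j))
    ≡⟨ sum-cong-≗ (λ i → trans (sym (∑-distrib-+ (inversion i) (λ j → descent i (R i) j (R j))))
                               (sum-cong-≗ (pair i))) ⟩
  ∑[ i < p ] ∑[ j < p ] 𝟙 (i <? j) ∎
  where
  inversion : Fin p → Fin p → ℕ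
  inversion i j = 𝟙 (i <? j) * 𝟙 (z j ℤ.<? z i)

  inversion-or-descent : ∀ {i j} → i < j → 𝟙 (z j ℤ.<? z i) + 𝟙 (R j ℕ.<? R i) ≡ 1
  inversion-or-descent {i} {j} i<j with R j ℕ.<? R i
  ... | yes Rj<Ri = cong₂ _+_ (𝟙-no (z j ℤ.<? z i) (ℤₚ.≤⇒≯ (antitone j i (<⇒≤ Rj<Ri))))
                               (𝟙-yes (R j ℕ.<? R i) Rj<Ri)
  ... | no Rj≮Ri  = cong₂ _+_ (𝟙-yes (z j ℤ.<? z i) zj<zi) (𝟙-no (R j ℕ.<? R i) Rj≮Ri)
    where
    zj<zi : z j ℤ.< z i
    zj<zi = ℤₚ.≤∧≢⇒< (antitone i j (≮⇒≥ Rj≮Ri))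
                     (λ zj≡zi → <⇒≢ i<j (cong toℕ (sym (z-distinct j i zj≡zi))))

  pair : ∀ i j → inversion i j + descent i (R i) j (R j) ≡ 𝟙 (i <? j)
  pair i j with i <? j
  ... | yes i<j rewrite 𝟙-yes (i <? j) i<j =
    trans (cong₂ _+_ (+-identityʳ (𝟙 (z j ℤ.<? z i))) (+-identityʳ (𝟙 (R j ℕ.<? R i))))
          (inversion-or-descent i<j)
  ... | no i≮j rewrite 𝟙-no (i <? j) i≮j = refl

descents-across : ∀ {k p} {σ : Fin k → Fin p} → Injective _≡_ _≡_ σ → (R : Fin p → ℕ) →
  (∀ {j j′} → preimage σ j ≡ nothing → preimage σ j′ ≡ nothing → descent j (R j) j′ (R j′) ≡ 0) →
  (∀ i i′ → descent (σ i) (R (σ i)) (σ i′) (R (σ i′)) ≡ 0) →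
  descents R ≡ ∑[ i < k ] ∑[ j < p ] (offImage σ j * discordant j (R j) (σ i) (R (σ i)))
descents-across {k} {p} {σ} σ-inj R outside inside = begin
  ∑[ j < p ] ∑[ j′ < p ] D j j′
    ≡⟨ ∑-split-image σ-inj (λ j → ∑[ j′ < p ] D j j′) ⟩
  ∑[ j < p ] (offImage σ j * ∑[ j′ < p ] D j j′) + ∑[ i < k ] ∑[ j′ < p ] D (σ i) j′
    ≡⟨ cong₂ _+_ from-outside from-image ⟩
  ∑[ i < k ] ∑[ j < p ] (offImage σ j * D j (σ i))
    + ∑[ i < k ] ∑[ j < p ] (offImage σ j * D (σ i) j)
    ≡⟨ sym (∑-distrib-+ (λ i → ∑[ j < p ] (offImage σ j * D j (σ i)))
                        (λ i → ∑[ j < p ] (offImage σ j * D (σ i) j))) ⟩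
  ∑[ i < k ] (∑[ j < p ] (offImage σ j * D j (σ i)) + ∑[ j < p ] (offImage σ j * D (σ i) j))
    ≡⟨ sum-cong-≗ (λ i → trans (sym (∑-distrib-+ (λ j → offImage σ j * D j (σ i))
                                                 (λ j → offImage σ j * D (σ i) j)))
                               (sum-cong-≗ λ j → sym (*-distribˡ-+ (offImage σ j) _ _))) ⟩
  ∑[ i < k ] ∑[ j < p ] (offImage σ j * discordant j (R j) (σ i) (R (σ i))) ∎
  where
  D : Fin p → Fin p → ℕ
  D j j′ = descent j (R j) j′ (R j′)

  across : ∀ {j} → preimage σ j ≡ nothing → ∑[ j′ < p ] D j j′ ≡ ∑[ i < k ] D j (σ i)
  across {j} eq = trans (∑-split-image σ-inj (D j))
    (cong (_+ ∑[ i < k ] D j (σ i))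
          (∑-zero _ λ j′ → trans (offImage-*-cong σ j′ (outside eq)) (*-zeroʳ (offImage σ j′))))

  from-outside : ∑[ j < p ] (offImage σ j * ∑[ j′ < p ] D j j′)
                   ≡ ∑[ i < k ] ∑[ j < p ] (offImage σ j * D j (σ i))
  from-outside = begin
    ∑[ j < p ] (offImage σ j * ∑[ j′ < p ] D j j′)
      ≡⟨ sum-cong-≗ (λ j → offImage-*-cong σ j across) ⟩
    ∑[ j < p ] (offImage σ j * ∑[ i < k ] D j (σ i))
      ≡⟨ sum-cong-≗ (λ j → *-distribˡ-sum (offImage σ j) (λ i → D j (σ i))) ⟩
    ∑[ j < p ] ∑[ i < k ] (offImage σ j * D j (σ i))
      ≡⟨ ∑-comm (λ j i → offImage σ j * D j (σ i)) ⟩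
    ∑[ i < k ] ∑[ j < p ] (offImage σ j * D j (σ i)) ∎

  from-image : ∑[ i < k ] ∑[ j′ < p ] D (σ i) j′ ≡ ∑[ i < k ] ∑[ j < p ] (offImage σ j * D (σ i) j)
  from-image = sum-cong-≗ λ i →
    trans (∑-split-image σ-inj (D (σ i)))
          (trans (cong (∑[ j < p ] (offImage σ j * D (σ i) j) +_) (∑-zero _ (inside i)))
                 (+-identityʳ _))

Slot : ℕ → Set
Slot p = Fin p × Bool

-- The slots (l , false) and (l , true) stand for a_l and b_l; rank is their place in the
-- chain a₁ ≥ b₁ > a₂ ≥ b₂ > ⋯, along which value is antitone.
rank : ∀ {p} → Slot p → ℕ
rank (l , false) = 2 * toℕ l
rank (l , true)  = suc (2 * toℕ l)

value : ∀ {p} → Seq p → Seq p → Slot p → ℤ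
value a b (l , false) = a l
value a b (l , true)  = b l

rank-monoˡ : ∀ {p} {l l′ : Fin p} {t} → l ≤ l′ → rank (l , t) ℕ.≤ rank (l′ , t)
rank-monoˡ {t = false} l≤l′ = *-monoʳ-≤ 2 l≤l′
rank-monoˡ {t = true}  l≤l′ = s≤s (*-monoʳ-≤ 2 l≤l′)

rank-< : ∀ {p} {l l′ : Fin p} t t′ → l < l′ → rank (l , t) ℕ.< rank (l′ , t′)
rank-< {l = l} {l′} t t′ l<l′ =
  ≤-trans (s≤s (rank≤1+2l t)) (≤-trans 2+2l≤2l′ (2l≤rank t′))
  where
  rank≤1+2l : ∀ {l : Fin _} t → rank (l , t) ℕ.≤ suc (2 * toℕ l)
  rank≤1+2l false = n≤1+n _
  rank≤1+2l true  = ≤-refl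
  2l≤rank : ∀ {l : Fin _} t → 2 * toℕ l ℕ.≤ rank (l , t)
  2l≤rank false = ≤-refl
  2l≤rank true  = n≤1+n _
  2+2l≤2l′ : 2 + 2 * toℕ l ℕ.≤ 2 * toℕ l′
  2+2l≤2l′ = ≤-trans (≤-reflexive (sym (*-suc 2 (toℕ l)))) (*-monoʳ-≤ 2 l<l′)

module _ {p} {a b : Seq p} (interlacing : Interlacing a b) where

  a<b-beyond : ∀ d {l l′ : Fin p} → toℕ l′ ≡ suc (d + toℕ l) → a l′ ℤ.< b l
  a<b-beyond zero    l′≡1+l = proj₂ interlacing _ _ l′≡1+l
  a<b-beyond (suc d) {l} {l′} l′≡2+d+l =
    ℤₚ.<-trans (ℤₚ.<-≤-trans (proj₂ interlacing m l′ l′≡1+m) (proj₁ interlacing m))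
               (a<b-beyond d m≡1+d+l)
    where
    m<p : suc (d + toℕ l) ℕ.< p
    m<p = <⇒≤ (subst (ℕ._< p) l′≡2+d+l (Finₚ.toℕ<n l′))
    m : Fin p
    m = fromℕ< m<p
    m≡1+d+l : toℕ m ≡ suc (d + toℕ l)
    m≡1+d+l = Finₚ.toℕ-fromℕ< m<p
    l′≡1+m : toℕ l′ ≡ suc (toℕ m)
    l′≡1+m = trans l′≡2+d+l (cong suc (sym m≡1+d+l))

  a<b : ∀ {l l′ : Fin p} → l < l′ → a l′ ℤ.< b l
  a<b {l} {l′} l<l′ = a<b-beyond (toℕ l′ ∸ suc (toℕ l))
    (trans (sym (m+[n∸m]≡n l<l′)) (trans (+-comm (suc (toℕ l)) _) (+-suc _ (toℕ l))))

  value-antitone : ∀ {u v : Slot p} → rank u ℕ.≤ rank v → value a b v ℤ.≤ value a b u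
  value-antitone {l , t} {l′ , t′} ru≤rv with Finₚ.<-cmp l l′
  ... | tri< l<l′ _ _ = ℤₚ.<⇒≤ (ℤₚ.≤-<-trans (value≤a t′) (ℤₚ.<-≤-trans (a<b l<l′) (b≤value t)))
    where
    value≤a : ∀ {l} t → value a b (l , t) ℤ.≤ a l
    value≤a false = ℤₚ.≤-refl
    value≤a true  = proj₁ interlacing _
    b≤value : ∀ {l} t → b l ℤ.≤ value a b (l , t)
    b≤value false = proj₁ interlacing _
    b≤value true  = ℤₚ.≤-refl
  ... | tri≈ _ refl _ = same-position t t′ ru≤rv
    where
    same-position : ∀ t t′ → rank (l , t) ℕ.≤ rank (l , t′) →
                    value a b (l , t′) ℤ.≤ value a b (l , t)
    same-position false false _   = ℤₚ.≤-refl
    same-position false true  _   = proj₁ interlacing l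
    same-position true  true  _   = ℤₚ.≤-refl
    same-position true  false 1+2l≤2l = contradiction 1+2l≤2l (<-irrefl refl)
  ... | tri> _ _ l′<l = contradiction ru≤rv (<⇒≱ (rank-< t′ t l′<l))

replace-antitone : ∀ {k p} {a b : Seq p} → Interlacing a b →
                   (f : Fin p → Slot p) (σ : Fin k → Fin p) (g : Fin k → Slot p) →
                   ∀ i j → rank (fill f σ g i) ℕ.≤ rank (fill f σ g j) →
                   replace (value a b ∘ f) σ (value a b ∘ g) j
                     ℤ.≤ replace (value a b ∘ f) σ (value a b ∘ g) i
replace-antitone {a = a} {b} interlacing f σ g i j ri≤rj =
  subst₂ ℤ._≤_ (sym (replace≡fill (value a b) f σ g j)) (sym (replace≡fill (value a b) f σ g i))
         (value-antitone interlacing {fill f σ g i} {fill f σ g j} ri≤rj)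

descents-fill : ∀ {k p} {π ρ : Fin k → Fin p} → StrictlyIncreasing π → StrictlyIncreasing ρ →
  ∀ t t′ →
  descents (rank ∘ fill (_, t) π (λ i → ρ i , t′))
    ≡ ∑[ i < k ] ∑[ j < p ] (offImage π j * discordant j (rank (j , t)) (π i) (rank (ρ i , t′)))
descents-fill {π = π} {ρ} π↑ ρ↑ t t′ =
  trans (descents-across π-inj R outside inside)
        (sum-cong-≗ λ i → sum-cong-≗ λ j → offImage-*-cong π j λ eq →
          cong₂ (λ r r′ → discordant j r (π i) r′)
                (cong rank (fill-missing (_, t) g eq)) (cong rank (fill-image (_, t) g π-inj i)))
  where
  π-inj : Injective _≡_ _≡_ π
  π-inj = strictlyIncreasing⇒injective π↑
  g : Fin _ → Slot _
  g i = ρ i , t′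
  R : Fin _ → ℕ
  R = rank ∘ fill (_, t) π g

  outside : ∀ {j j′} → preimage π j ≡ nothing → preimage π j′ ≡ nothing →
            descent j (R j) j′ (R j′) ≡ 0
  outside {j} {j′} eq eq′ rewrite fill-missing (_, t) g eq | fill-missing (_, t) g eq′ =
    descent-ordered {r = rank (j , t)} {rank (j′ , t)} (rank-monoˡ {t = t} ∘ <⇒≤)

  inside : ∀ i i′ → descent (π i) (R (π i)) (π i′) (R (π i′)) ≡ 0
  inside i i′ rewrite fill-image (_, t) g π-inj i | fill-image (_, t) g π-inj i′ =
    descent-ordered {r = rank (ρ i , t′)} {rank (ρ i′ , t′)}
      (rank-monoˡ {t = t′} ∘ <⇒≤ ∘ ρ↑ i i′ ∘ strictlyIncreasing-reflects-< π↑)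

-- crossˣ j s t compares a_j at position j with b_t at position s, and crossʸ j s t compares
-- b_j at position j with a_s at position t.
crossˣ crossʸ between : ∀ {p} → Fin p → Fin p → Fin p → ℕ
crossˣ j s t = discordant j (rank (j , false)) s (rank (t , true))
crossʸ j s t = discordant j (rank (j , true)) t (rank (s , false))
between j s t = 𝟙 (j <? s) * 𝟙 (t <? j) + 𝟙 (s <? j) * 𝟙 (j <? t)

crossˣ-positions : ∀ {p} (j s t : Fin p) →
                   crossˣ j s t ≡ 𝟙 (j <? s) * 𝟙 (t <? j) + 𝟙 (s <? j) * 𝟙 (j ≤? t)
crossˣ-positions j s t = cong₂ _+_ (cong (𝟙 (j <? s) *_) (𝟙-1+2m<2n (toℕ t) (toℕ j)))
                                   (cong (𝟙 (s <? j) *_) (𝟙-2m<1+2n (toℕ j) (toℕ t)))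

crossʸ-positions : ∀ {p} (j s t : Fin p) →
                   crossʸ j s t ≡ 𝟙 (j <? t) * 𝟙 (s ≤? j) + 𝟙 (t <? j) * 𝟙 (j <? s)
crossʸ-positions j s t = cong₂ _+_ (cong (𝟙 (j <? t) *_) (𝟙-2m<1+2n (toℕ s) (toℕ j)))
                                   (cong (𝟙 (t <? j) *_) (𝟙-1+2m<2n (toℕ j) (toℕ s)))

crossˣ-between : ∀ {p} (j s t : Fin p) → crossˣ j s t ≡ between j s t + 𝟙 (t ≟ j) * 𝟙 (s <? t)
crossˣ-between j s t = begin
  crossˣ j s t
    ≡⟨ crossˣ-positions j s t ⟩
  𝟙 (j <? s) * 𝟙 (t <? j) + 𝟙 (s <? j) * 𝟙 (j ≤? t)
    ≡⟨ cong (λ n → 𝟙 (j <? s) * 𝟙 (t <? j) + 𝟙 (s <? j) * n) (𝟙-≤-split j t) ⟩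
  𝟙 (j <? s) * 𝟙 (t <? j) + 𝟙 (s <? j) * (𝟙 (j <? t) + 𝟙 (j ≟ t))
    ≡⟨ cong (𝟙 (j <? s) * 𝟙 (t <? j) +_) (*-distribˡ-+ (𝟙 (s <? j)) (𝟙 (j <? t)) (𝟙 (j ≟ t))) ⟩
  𝟙 (j <? s) * 𝟙 (t <? j) + (𝟙 (s <? j) * 𝟙 (j <? t) + 𝟙 (s <? j) * 𝟙 (j ≟ t))
    ≡⟨ sym (+-assoc (𝟙 (j <? s) * 𝟙 (t <? j)) (𝟙 (s <? j) * 𝟙 (j <? t))
                    (𝟙 (s <? j) * 𝟙 (j ≟ t))) ⟩
  between j s t + 𝟙 (s <? j) * 𝟙 (j ≟ t)
    ≡⟨ cong (between j s t +_) (trans (cong (𝟙 (s <? j) *_) (𝟙-≟-sym j t))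
                                      (𝟙-≟-transport (s <?_) t j)) ⟩
  between j s t + 𝟙 (t ≟ j) * 𝟙 (s <? t) ∎

crossʸ-between : ∀ {p} (j s t : Fin p) → crossʸ j s t ≡ between j s t + 𝟙 (s ≟ j) * 𝟙 (s <? t)
crossʸ-between j s t = begin
  crossʸ j s t
    ≡⟨ crossʸ-positions j s t ⟩
  𝟙 (j <? t) * 𝟙 (s ≤? j) + 𝟙 (t <? j) * 𝟙 (j <? s)
    ≡⟨ cong (λ n → 𝟙 (j <? t) * n + 𝟙 (t <? j) * 𝟙 (j <? s)) (𝟙-≤-split s j) ⟩
  𝟙 (j <? t) * (𝟙 (s <? j) + 𝟙 (s ≟ j)) + 𝟙 (t <? j) * 𝟙 (j <? s)
    ≡⟨ regroup (𝟙 (j <? t)) (𝟙 (s <? j)) (𝟙 (s ≟ j)) (𝟙 (t <? j)) (𝟙 (j <? s)) ⟩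
  between j s t + 𝟙 (j <? t) * 𝟙 (s ≟ j)
    ≡⟨ cong (between j s t +_) (𝟙-≟-transport (_<? t) s j) ⟩
  between j s t + 𝟙 (s ≟ j) * 𝟙 (s <? t) ∎
  where
  regroup : ∀ a b e c d → a * (b + e) + c * d ≡ (d * c + b * a) + a * e
  regroup = solve-∀

∑-crossˣ≡∑-crossʸ : ∀ {p} (s t : Fin p) → ∑[ j < p ] crossˣ j s t ≡ ∑[ j < p ] crossʸ j s t
∑-crossˣ≡∑-crossʸ {p} s t = begin
  ∑[ j < p ] crossˣ j s t
    ≡⟨ sum-cong-≗ (λ j → crossˣ-between j s t) ⟩
  ∑[ j < p ] (between j s t + 𝟙 (t ≟ j) * s<t)
    ≡⟨ ∑-distrib-+ (λ j → between j s t) (λ j → 𝟙 (t ≟ j) * s<t) ⟩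
  ∑[ j < p ] between j s t + ∑[ j < p ] (𝟙 (t ≟ j) * s<t)
    ≡⟨ cong (∑[ j < p ] between j s t +_)
            (trans (∑-δ t (λ _ → s<t)) (sym (∑-δ s (λ _ → s<t)))) ⟩
  ∑[ j < p ] between j s t + ∑[ j < p ] (𝟙 (s ≟ j) * s<t)
    ≡⟨ sym (∑-distrib-+ (λ j → between j s t) (λ j → 𝟙 (s ≟ j) * s<t)) ⟩
  ∑[ j < p ] (between j s t + 𝟙 (s ≟ j) * s<t)
    ≡⟨ sum-cong-≗ (λ j → sym (crossʸ-between j s t)) ⟩
  ∑[ j < p ] crossʸ j s t ∎
  where
  s<t : ℕ
  s<t = 𝟙 (s <? t)

-- The slots of the entries of 𝔞|_{𝔠←𝔡} and 𝔟|_{𝔡←𝔠}, where 𝔠 = a ∘ σ and 𝔡 = b ∘ τ.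
slotˣ slotʸ : ∀ {k p} → (σ τ : Fin k → Fin p) → Fin p → Slot p
slotˣ σ τ = fill (_, false) σ (λ i → τ i , true)
slotʸ σ τ = fill (_, true) τ (λ i → σ i , false)

module _ {k p} {σ τ : Fin k → Fin p} (σ↑ : StrictlyIncreasing σ) (τ↑ : StrictlyIncreasing τ) where

  crossˣ-image≡crossʸ-image : ∀ i i′ → crossˣ (σ i) (σ i′) (τ i′) ≡ crossʸ (τ i′) (σ i) (τ i)
  crossˣ-image≡crossʸ-image i i′
    rewrite crossˣ-positions (σ i) (σ i′) (τ i′) | crossʸ-positions (τ i′) (σ i) (τ i)
    with Finₚ.<-cmp i i′
  ... | tri< i<i′ _ _
    rewrite 𝟙-yes (σ i <? σ i′) (σ↑ i i′ i<i′) | 𝟙-no (σ i′ <? σ i) (<⇒≯ (σ↑ i i′ i<i′))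
          | 𝟙-no (τ i′ <? τ i) (<⇒≯ (τ↑ i i′ i<i′)) | 𝟙-yes (τ i <? τ i′) (τ↑ i i′ i<i′)
    = +-identityʳ _
  ... | tri≈ _ refl _
    rewrite 𝟙-no (σ i <? σ i) (<-irrefl refl) | 𝟙-no (τ i <? τ i) (<-irrefl refl)
    = refl
  ... | tri> _ _ i′<i
    rewrite 𝟙-no (σ i <? σ i′) (<⇒≯ (σ↑ i′ i i′<i)) | 𝟙-yes (σ i′ <? σ i) (σ↑ i′ i i′<i)
          | 𝟙-yes (τ i′ <? τ i) (τ↑ i′ i i′<i) | 𝟙-no (τ i <? τ i′) (<⇒≯ (τ↑ i′ i i′<i))
    = sym (+-identityʳ _)

  descents-exchange : descents (rank ∘ slotˣ σ τ) ≡ descents (rank ∘ slotʸ σ τ)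
  descents-exchange = +-cancelʳ-≡ selected _ _ (begin
    descents (rank ∘ slotˣ σ τ) + selected
      ≡⟨ cong (_+ selected) (descents-fill σ↑ τ↑ false true) ⟩
    ∑[ i < k ] ∑[ j < p ] (offImage σ j * crossˣ j (σ i) (τ i)) + selected
      ≡⟨ ∑∑-split-image (strictlyIncreasing⇒injective σ↑) (λ j i → crossˣ j (σ i) (τ i)) ⟩
    ∑[ i < k ] ∑[ j < p ] crossˣ j (σ i) (τ i)
      ≡⟨ sum-cong-≗ (λ i → ∑-crossˣ≡∑-crossʸ (σ i) (τ i)) ⟩
    ∑[ i < k ] ∑[ j < p ] crossʸ j (σ i) (τ i)
      ≡⟨ sym (∑∑-split-image (strictlyIncreasing⇒injective τ↑) (λ j i → crossʸ j (σ i) (τ i))) ⟩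
    ∑[ i < k ] ∑[ j < p ] (offImage τ j * crossʸ j (σ i) (τ i))
      + ∑[ i < k ] ∑[ i′ < k ] crossʸ (τ i′) (σ i) (τ i)
      ≡⟨ cong₂ _+_ (sym (descents-fill τ↑ σ↑ true false)) selected-exchange ⟩
    descents (rank ∘ slotʸ σ τ) + selected ∎)
    where
    selected : ℕ
    selected = ∑[ i < k ] ∑[ i′ < k ] crossˣ (σ i′) (σ i) (τ i)
    selected-exchange : ∑[ i < k ] ∑[ i′ < k ] crossʸ (τ i′) (σ i) (τ i) ≡ selected
    selected-exchange =
      trans (sum-cong-≗ λ i → sum-cong-≗ λ i′ → sym (crossˣ-image≡crossʸ-image i i′))
            (∑-comm (λ i i′ → crossˣ (σ i) (σ i′) (τ i′)))

lemma4p3 : (p k : ℕ) (a b : Seq p) → Interlacing a b →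
    (σ τ : Fin k → Fin p) → StrictlyIncreasing σ → StrictlyIncreasing τ →
    Distinct (replace a σ (λ i → b (τ i))) →
    Distinct (replace b τ (λ i → a (σ i))) →
    inv (replace a σ (λ i → b (τ i))) ≡ inv (replace b τ (λ i → a (σ i)))
lemma4p3 p k a b interlacing σ τ σ↑ τ↑ x-distinct y-distinct =
  +-cancelʳ-≡ (descents Rˣ) _ _ (begin
    inv x + descents Rˣ
      ≡⟨ inv+descents x Rˣ x-distinct
           (replace-antitone interlacing (_, false) σ (λ i → τ i , true)) ⟩
    ∑[ i < p ] ∑[ j < p ] 𝟙 (i <? j)
      ≡⟨ sym (inv+descents y Rʸ y-distinct
                (replace-antitone interlacing (_, true) τ (λ i → σ i , false))) ⟩
    inv y + descents Rʸ
      ≡⟨ cong (inv y +_) (sym (descents-exchange σ↑ τ↑)) ⟩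
    inv y + descents Rˣ ∎)
  where
  x y : Seq p
  x = replace a σ (λ i → b (τ i))
  y = replace b τ (λ i → a (σ i))
  Rˣ Rʸ : Fin p → ℕ
  Rˣ = rank ∘ slotˣ σ τ
  Rʸ = rank ∘ slotʸ σ τ
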